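{- For $n \ge 0$ let $R(n)$ be the largest positive integer that can be reached from $1$ by applying the Choix de Bruxelles operation exactly $n$ times (in succession). Then for all $n \ge 14$, $$8.112\cdot 10^{n-6} < R(n) \le 8.113\cdot 10^{n-6}.$$
   Context: The Choix de Bruxelles operation: given a positive integer $n$ with decimal expansion $d_1 d_2 \ldots d_k$, choose indices $1 \le p \le q \le k$ with $d_p \neq 0$, let $s$ be the number with decimal representation $d_p d_{p+1}\ldots d_q$, and replace this substring in situ by the decimal expansion of $2s$, or, if $s$ is even, by the decimal expansion of $s/2$. One may also leave $n$ unchanged (empty substring). -}

module Defs where

open import Data.Nat using (ℕ; zero; suc; _+_; _*_; _<_; _≤_)
open import Data.List using (List; []; _∷_; _++_; foldl)
open import Data.List.Relation.Unary.All using (All)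
open import Data.Product using (Σ; ∃; _×_; _,_)
open import Data.Sum using (_⊎_)
open import Relation.Binary.PropositionalEquality using (_≡_; _≢_)

value : List ℕ → ℕ
value = foldl (λ acc d → 10 * acc + d) 0

data LeadingNonzero : List ℕ → Set where
  lead : ∀ {d ds} → d ≢ 0 → LeadingNonzero (d ∷ ds)

DecExp : ℕ → List ℕ → Set
DecExp n ds = All (_< 10) ds × LeadingNonzero ds × value ds ≡ n

Replace : ℕ → ℕ → Set
Replace s t = t ≡ 2 * s ⊎ 2 * t ≡ s

Step : ℕ → ℕ → Set
Step m m' =
  m' ≡ m ⊎
  (Σ (List ℕ) λ a → Σ (List ℕ) λ b → Σ (List ℕ) λ c → Σ ℕ λ t → Σ (List ℕ) λ e →
     DecExp m (a ++ b ++ c) × LeadingNonzero b × Replace (value b) t ×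
     DecExp t e × m' ≡ value (a ++ e ++ c))

data Reach : ℕ → ℕ → Set where
  start : Reach 0 1
  step  : ∀ {n m m'} → Reach n m → Step m m' → Reach (suc n) m'

IsR : ℕ → ℕ → Set
IsR n r = Reach n r × (∀ m → Reach n m → m ≤ r)

module Submission where

open import Defs
open import Data.Nat using (ℕ; zero; suc; _+_; _*_; _^_; _∸_; _<_; _≤_; z≤n; s≤s; s≤s⁻¹; _<?_; NonZero;
  ≢-nonZero; ≢-nonZero⁻¹; >-nonZero; _/_; _%_)
open import Data.Nat.Properties
open import Algebra.Properties.CommutativeSemigroup *-commutativeSemigroup using (x∙yz≈y∙xz)
open import Data.Nat.DivMod using (m≡m%n+[m/n]*n; m%n<n; m/n<m; m≥n⇒m/n>0; m*n/n≡m; m<n⇒m/n≡0; +-distrib-/-∣ˡ)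
open import Data.Nat.Divisibility using (n∣m*n)
open import Data.Nat.Tactic.RingSolver using (solve-∀)
open import Data.Fin using (Fin; toℕ; fromℕ<)
open import Data.Fin.Properties using (toℕ-fromℕ<)
import Data.Fin.Properties as Fin
open import Data.List using (List; []; _∷_; _++_; foldl; length; map; concatMap)
open import Data.List.Properties using (foldl-++; ++-assoc)
open import Data.List.Relation.Unary.All using (All; []; _∷_; all?; lookup; lookupAny)
open import Data.List.Relation.Unary.All.Properties using (++⁺; ++⁻ˡ; ++⁻ʳ)
open import Data.List.Relation.Unary.Any using (Any; here; there)
import Data.List.Relation.Unary.Any as Any
open import Data.List.Relation.Unary.Any.Properties using (map⁺; concatMap⁺)
open import Data.List.Membership.Propositional using (_∈_; lose)
open import Data.List.Membership.Propositional.Properties using (∈-map⁺)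
open import Data.List.Membership.DecPropositional _≟_ using (_∈?_)
open import Data.List.Extrema.Nat using (argmax; f[⊥]≤f[argmax]; f[xs]≤f[argmax])
open import Data.Product using (Σ; ∃₂; _×_; _,_; proj₁; proj₂; map₂)
open import Data.Sum using (_⊎_; inj₁; inj₂)
open import Relation.Binary.PropositionalEquality
open import Relation.Nullary using (Dec; yes; no; contradiction)
open import Relation.Nullary.Decidable using (_×-dec_; _⊎-dec_; True; toWitness)

-- One operation multiplies a number by at most 10: the new block has at most one
-- digit more than the old one. So a number m reachable in n ≤ 14 steps can lead to a number above
-- 8113·10⁵ at step 14 only if m·10^(14-n) > 8113·10⁵. Level by level there are only a few such
-- numbers, and evaluating the list of all their successors shows that none are left at step 14;
-- after that the bound grows tenfold per step. Doubling blocks leads from 1 to 88224 in ten steps; from then on the four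
-- doublings 8224 → 16448 → 164416 → 1644112 → 11288224 repeat, each round inserting 1128 after
-- the leading 8, so R(14 + k) ≥ 81128·10^(4+k).
-- R(n) exists because the successors of a number, hence the numbers reachable in n steps, can be
-- listed completely.

-- Decimal expansions

value-from : ∀ acc ds → foldl (λ acc d → 10 * acc + d) acc ds ≡ acc * 10 ^ length ds + value ds
value-from acc [] = sym (trans (+-identityʳ _) (*-identityʳ acc))
value-from acc (d ∷ ds) = begin
  foldl _ (10 * acc + d) ds             ≡⟨ value-from (10 * acc + d) ds ⟩
  (10 * acc + d) * P + value ds         ≡⟨ regroup acc d P (value ds) ⟩
  acc * (10 * P) + (d * P + value ds)   ≡⟨ cong (acc * (10 * P) +_) (value-from d ds) ⟨
  acc * (10 * P) + value (d ∷ ds)       ∎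
  where open ≡-Reasoning
        P = 10 ^ length ds
        regroup : ∀ a d P v → (10 * a + d) * P + v ≡ a * (10 * P) + (d * P + v)
        regroup = solve-∀

value-++ : ∀ xs ys → value (xs ++ ys) ≡ value xs * 10 ^ length ys + value ys
value-++ xs ys = trans (foldl-++ _ 0 xs ys) (value-from (value xs) ys)

value-++-++ : ∀ a b c → value (a ++ b ++ c) ≡ (value a * 10 ^ length b + value b) * 10 ^ length c + value c
value-++-++ a b c = begin
  value (a ++ b ++ c)                       ≡⟨ cong value (++-assoc a b c) ⟨
  value ((a ++ b) ++ c)                     ≡⟨ value-++ (a ++ b) c ⟩
  value (a ++ b) * 10 ^ length c + value c  ≡⟨ cong (λ v → v * 10 ^ length c + value c) (value-++ a b) ⟩
  (value a * 10 ^ length b + value b) * 10 ^ length c + value c ∎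
  where open ≡-Reasoning

value<10^length : ∀ {ds} → All (_< 10) ds → value ds < 10 ^ length ds
value<10^length [] = s≤s z≤n
value<10^length {d ∷ ds} (d<10 ∷ ds<10) = begin-strict
  value (d ∷ ds)   ≡⟨ value-++ (d ∷ []) ds ⟩
  d * P + value ds <⟨ +-monoʳ-< (d * P) (value<10^length ds<10) ⟩
  d * P + P        ≡⟨ +-comm (d * P) P ⟩
  suc d * P        ≤⟨ *-monoˡ-≤ P d<10 ⟩
  10 * P           ∎
  where open ≤-Reasoning
        P = 10 ^ length ds

10^length≤10*value : ∀ {ds} → LeadingNonzero ds → 10 ^ length ds ≤ 10 * value ds
10^length≤10*value {d ∷ ds} (lead d≢0) = *-monoʳ-≤ 10 (begin
  P                ≤⟨ m≤n*m P d {{≢-nonZero d≢0}} ⟩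
  d * P            ≤⟨ m≤m+n (d * P) (value ds) ⟩
  d * P + value ds ≡⟨ value-++ (d ∷ []) ds ⟨
  value (d ∷ ds)   ∎)
  where open ≤-Reasoning
        P = 10 ^ length ds

lead-++ : ∀ {xs ys} → LeadingNonzero xs → LeadingNonzero (xs ++ ys)
lead-++ (lead d≢0) = lead d≢0

DecExp⇒NonZero : ∀ {n ds} → DecExp n ds → NonZero n
DecExp⇒NonZero {zero} {ds} (_ , lead-ds , value≡0) =
  contradiction (subst (λ v → 10 ^ length ds ≤ 10 * v) value≡0 (10^length≤10*value lead-ds))
                (<⇒≱ (m^n>0 10 (length ds)))
DecExp⇒NonZero {suc n} _ = _

^-cancelʳ-< : ∀ m .{{_ : NonZero m}} {a b} → m ^ a < m ^ b → a < b
^-cancelʳ-< m {a} {b} mᵃ<mᵇ with a <? b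
... | yes a<b = a<b
... | no a≮b = contradiction (^-monoʳ-≤ m (≮⇒≥ a≮b)) (<⇒≱ mᵃ<mᵇ)

DecExp-length-≤ : ∀ {n xs ys} → DecExp n xs → DecExp n ys → length xs ≤ length ys
DecExp-length-≤ {n} {xs} {ys} (_ , lead-xs , value-xs≡n) (ys<10 , _ , value-ys≡n) =
  s≤s⁻¹ (^-cancelʳ-< 10 (begin-strict
    10 ^ length xs          ≤⟨ 10^length≤10*value lead-xs ⟩
    10 * value xs           ≡⟨ cong (10 *_) (trans value-xs≡n (sym value-ys≡n)) ⟩
    10 * value ys           <⟨ *-monoʳ-< 10 (value<10^length ys<10) ⟩
    10 ^ suc (length ys)    ∎))
  where open ≤-Reasoning

[q*n+r]/n≡q : ∀ q {n r} .{{_ : NonZero n}} → r < n → (q * n + r) / n ≡ q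
[q*n+r]/n≡q q {n} {r} r<n = begin
  (q * n + r) / n   ≡⟨ +-distrib-/-∣ˡ r (n∣m*n q) ⟩
  q * n / n + r / n ≡⟨ cong₂ _+_ (m*n/n≡m q n) (m<n⇒m/n≡0 r<n) ⟩
  q + 0             ≡⟨ +-identityʳ q ⟩
  q                 ∎
  where open ≡-Reasoning

digit-lists-injective : ∀ {xs ys} → All (_< 10) xs → All (_< 10) ys →
                        length xs ≡ length ys → value xs ≡ value ys → xs ≡ ys
digit-lists-injective [] [] _ _ = refl
digit-lists-injective {x ∷ xs} {y ∷ ys} (_ ∷ xs<10) (_ ∷ ys<10) |x∷xs|≡|y∷ys| values≡ =
  cong₂ _∷_ x≡y (digit-lists-injective xs<10 ys<10 |xs|≡|ys| (+-cancelˡ-≡ (x * P) _ _ tails≡))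
  where
    P = 10 ^ length xs
    instance _ = m^n≢0 10 (length xs)
    |xs|≡|ys| = suc-injective |x∷xs|≡|y∷ys|
    ys<P : value ys < P
    ys<P = subst (λ k → value ys < 10 ^ k) (sym |xs|≡|ys|) (value<10^length ys<10)
    heads≡ : x * P + value xs ≡ y * P + value ys
    heads≡ = begin
      x * P + value xs ≡⟨ value-++ (x ∷ []) xs ⟨
      value (x ∷ xs)   ≡⟨ values≡ ⟩
      value (y ∷ ys)   ≡⟨ value-++ (y ∷ []) ys ⟩
      y * 10 ^ length ys + value ys ≡⟨ cong (λ k → y * 10 ^ k + value ys) |xs|≡|ys| ⟨
      y * P + value ys ∎
      where open ≡-Reasoning
    x≡y : x ≡ y
    x≡y = trans (sym ([q*n+r]/n≡q x (value<10^length xs<10)))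
                (trans (cong (_/ P) heads≡) ([q*n+r]/n≡q y ys<P))
    tails≡ : x * P + value xs ≡ x * P + value ys
    tails≡ = trans heads≡ (cong (λ z → z * P + value ys) (sym x≡y))

DecExp-unique : ∀ {n xs ys} → DecExp n xs → DecExp n ys → xs ≡ ys
DecExp-unique xs-exp@(xs<10 , _ , value-xs) ys-exp@(ys<10 , _ , value-ys) =
  digit-lists-injective xs<10 ys<10
    (≤-antisym (DecExp-length-≤ xs-exp ys-exp) (DecExp-length-≤ ys-exp xs-exp))
    (trans value-xs (sym value-ys))

-- Fuel n suffices for n, since n / 10 < n.
digitsWithin : ℕ → ℕ → List ℕ
digitsWithin zero n = []
digitsWithin (suc fuel) n with n <? 10
... | yes _ = n ∷ []
... | no _ = digitsWithin fuel (n / 10) ++ n % 10 ∷ []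

digits : ℕ → List ℕ
digits n = digitsWithin n n

digitsWithin-DecExp : ∀ fuel n .{{_ : NonZero n}} → n ≤ fuel → DecExp n (digitsWithin fuel n)
digitsWithin-DecExp zero (suc n) ()
digitsWithin-DecExp (suc fuel) n n≤fuel with n <? 10
... | yes n<10 = (n<10 ∷ []) , lead (≢-nonZero⁻¹ n) , refl
... | no n≮10 with digitsWithin-DecExp fuel (n / 10) {{>-nonZero (m≥n⇒m/n>0 (≮⇒≥ n≮10))}}
                     (s≤s⁻¹ (≤-trans (m/n<m n 10 (s≤s (s≤s z≤n))) n≤fuel))
...   | q<10 , lead-q , value-q = ++⁺ q<10 (m%n<n n 10 ∷ []) , lead-++ lead-q , (begin
  value (qs ++ n % 10 ∷ [])  ≡⟨ value-++ qs (n % 10 ∷ []) ⟩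
  value qs * 10 + n % 10     ≡⟨ cong (λ v → v * 10 + n % 10) value-q ⟩
  n / 10 * 10 + n % 10       ≡⟨ +-comm (n / 10 * 10) (n % 10) ⟩
  n % 10 + n / 10 * 10       ≡⟨ m≡m%n+[m/n]*n n 10 ⟨
  n                          ∎)
  where open ≡-Reasoning
        qs = digitsWithin fuel (n / 10)

digits-DecExp : ∀ n .{{_ : NonZero n}} → DecExp n (digits n)
digits-DecExp n = digitsWithin-DecExp n n ≤-refl

lnz? : ∀ ds → Dec (LeadingNonzero ds)
lnz? [] = no λ ()
lnz? (zero ∷ ds) = no λ { (lead 0≢0) → 0≢0 refl }
lnz? (suc d ∷ ds) = yes (lead λ ())

decExp? : ∀ n ds → Dec (DecExp n ds)
decExp? n ds = all? (_<? 10) ds ×-dec lnz? ds ×-dec (value ds ≟ n)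

-- Listing successors and reachable numbers

_∈₁_ : ∀ {A : Set} {P : A → Set} → A → List (Σ A P) → Set
x ∈₁ xs = Any (λ p → proj₁ p ≡ x) xs

All-∈₁ : ∀ {A : Set} {P : A → Set} {Q : A → Set} {xs : List (Σ A P)} {x} →
         All (λ p → Q (proj₁ p)) xs → x ∈₁ xs → Q x
All-∈₁ {Q = Q} qs x∈ with lookupAny qs x∈
... | q , eq = subst Q eq q

expansions : ∀ t → List (Σ (List ℕ) (DecExp t))
expansions zero = []
expansions t@(suc _) = (digits t , digits-DecExp t) ∷ []

expansions-complete : ∀ {t e} → DecExp t e → e ∈₁ expansions t
expansions-complete {zero} t-exp = contradiction (DecExp⇒NonZero t-exp) λ ()
expansions-complete {suc _} t-exp = here (DecExp-unique (digits-DecExp _) t-exp)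

halves : ∀ s → List (Σ ℕ (Replace s))
halves s with 2 * (s / 2) ≟ s
... | yes even = (s / 2 , inj₂ even) ∷ []
... | no _ = []

replacements : ∀ s → List (Σ ℕ (Replace s))
replacements s = (2 * s , inj₁ refl) ∷ halves s

replacements-complete : ∀ {s t} → Replace s t → t ∈₁ replacements s
replacements-complete (inj₁ refl) = here refl
replacements-complete {t = t} (inj₂ refl) = there halves-complete
  where
    half : 2 * t / 2 ≡ t
    half = trans (cong (_/ 2) (*-comm 2 t)) (m*n/n≡m t 2)
    halves-complete : t ∈₁ halves (2 * t)
    halves-complete with 2 * (2 * t / 2) ≟ 2 * t
    ... | yes _ = here half
    ... | no odd = contradiction (cong (2 *_) half) odd

splits : ∀ {A : Set} (ds : List A) → List (∃₂ λ xs ys → xs ++ ys ≡ ds)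
splits [] = ([] , [] , refl) ∷ []
splits (d ∷ ds) = ([] , d ∷ ds , refl) ∷ map (λ (xs , ys , eq) → d ∷ xs , ys , cong (d ∷_) eq) (splits ds)

splits-complete : ∀ {A : Set} (xs ys : List A) → (xs , ys , refl) ∈ splits (xs ++ ys)
splits-complete [] [] = here refl
splits-complete [] (_ ∷ _) = here refl
splits-complete (x ∷ xs) ys = there (∈-map⁺ _ (splits-complete xs ys))

Rewrite : ℕ → ℕ → Set
Rewrite m m′ =
  Σ (List ℕ) λ a → Σ (List ℕ) λ b → Σ (List ℕ) λ c → Σ ℕ λ t → Σ (List ℕ) λ e →
     DecExp m (a ++ b ++ c) × LeadingNonzero b × Replace (value b) t ×
     DecExp t e × m′ ≡ value (a ++ e ++ c)

rewritesAt : ∀ {m} a b c → DecExp m (a ++ b ++ c) → List (Σ ℕ (Rewrite m))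
rewritesAt a b c m-exp with lnz? b
... | no _ = []
... | yes lead-b = concatMap
  (λ (t , rep) → map
    (λ (e , t-exp) → value (a ++ e ++ c) , a , b , c , t , e , m-exp , lead-b , rep , t-exp , refl)
    (expansions t))
  (replacements (value b))

rewritesAt-complete : ∀ {m t e} a b c (m-exp : DecExp m (a ++ b ++ c)) → LeadingNonzero b →
                      Replace (value b) t → DecExp t e → value (a ++ e ++ c) ∈₁ rewritesAt a b c m-exp
rewritesAt-complete a b c m-exp lead-b rep t-exp with lnz? b
... | no ¬lead-b = contradiction lead-b ¬lead-b
... | yes _ = concatMap⁺ _ (Any.map
  (λ { refl → map⁺ (Any.map (cong (λ e → value (a ++ e ++ c))) (expansions-complete t-exp)) })
  (replacements-complete rep))

rewrites : ∀ {m} ds → DecExp m ds → List (Σ ℕ (Rewrite m))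
rewrites ds m-exp = concatMap
  (λ (a , r , a++r≡ds) → concatMap
    (λ (b , c , b++c≡r) →
      rewritesAt a b c (subst (DecExp _) (sym (trans (cong (a ++_) b++c≡r) a++r≡ds)) m-exp))
    (splits r))
  (splits ds)

rewrites-complete : ∀ {m t e} a b c (m-exp : DecExp m (a ++ b ++ c)) → LeadingNonzero b →
                    Replace (value b) t → DecExp t e → value (a ++ e ++ c) ∈₁ rewrites (a ++ b ++ c) m-exp
rewrites-complete a b c m-exp lead-b rep t-exp =
  concatMap⁺ _ (lose (splits-complete a (b ++ c))
    (concatMap⁺ _ (lose (splits-complete b c) (rewritesAt-complete a b c m-exp lead-b rep t-exp))))

successors : ∀ m → List (Σ ℕ (Step m))
successors m =
  (m , inj₁ refl) ∷ concatMap (λ (ds , m-exp) → map (map₂ inj₂) (rewrites ds m-exp)) (expansions m)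

successors-complete : ∀ {m m′} → Step m m′ → m′ ∈₁ successors m
successors-complete (inj₁ refl) = here refl
successors-complete (inj₂ (a , b , c , t , e , m-exp , lead-b , rep , t-exp , refl)) =
  there (concatMap⁺ _ (Any.map
    (λ { {_ , m-exp′} refl → map⁺ (rewrites-complete a b c m-exp′ lead-b rep t-exp) })
    (expansions-complete m-exp)))

reachables : ∀ n → List (Σ ℕ (Reach n))
reachables zero = (1 , start) ∷ []
reachables (suc n) = concatMap (λ (m , reach) → map (map₂ (step reach)) (successors m)) (reachables n)

reachables-complete : ∀ {n m} → Reach n m → m ∈₁ reachables n
reachables-complete start = here refl
reachables-complete (step reach s) =
  concatMap⁺ _ (Any.map (λ { refl → map⁺ (successors-complete s) }) (reachables-complete reach))

maximum : ∀ {P : ℕ → Set} (xs : List (Σ ℕ P)) → (∀ {m} → P m → m ∈₁ xs) → (w : Σ ℕ P) →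
          Σ ℕ λ r → (P r × (∀ m → P m → m ≤ r)) × proj₁ w ≤ r
maximum xs complete w =
  proj₁ top , (proj₂ top , λ _ pm → All-∈₁ (f[xs]≤f[argmax] {f = proj₁} w xs) (complete pm)) ,
  f[⊥]≤f[argmax] {f = proj₁} w xs
  where top = argmax proj₁ w xs

-- Growth under one operation

+-mono-≤-10* : ∀ {x u} y v → x ≤ 10 * y → u ≤ 10 * v → x + u ≤ 10 * (y + v)
+-mono-≤-10* y v x≤ u≤ = ≤-trans (+-mono-≤ x≤ u≤) (≤-reflexive (sym (*-distribˡ-+ 10 y v)))

*-monoˡ-≤-10* : ∀ {x} y z → x ≤ 10 * y → x * z ≤ 10 * (y * z)
*-monoˡ-≤-10* y z x≤ = ≤-trans (*-monoˡ-≤ z x≤) (≤-reflexive (*-assoc 10 y z))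

infix-growth : ∀ a b c e → 10 ^ length e ≤ 10 * 10 ^ length b → value e ≤ 10 * value b →
               value (a ++ e ++ c) ≤ 10 * value (a ++ b ++ c)
infix-growth a b c e E≤ ve≤ = begin
  value (a ++ e ++ c)                     ≡⟨ value-++-++ a e c ⟩
  (A * E + value e) * C + value c         ≤⟨ +-mono-≤-10* ((A * B + value b) * C) (value c)
                                               (*-monoˡ-≤-10* (A * B + value b) C prefix≤) (m≤n*m (value c) 10) ⟩
  10 * ((A * B + value b) * C + value c)  ≡⟨ cong (10 *_) (value-++-++ a b c) ⟨
  10 * value (a ++ b ++ c)                ∎
  where
    open ≤-Reasoning
    A = value a
    B = 10 ^ length b
    C = 10 ^ length c
    E = 10 ^ length e
    prefix≤ : A * E + value e ≤ 10 * (A * B + value b)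
    prefix≤ = +-mono-≤-10* (A * B) (value b) (≤-trans (*-monoʳ-≤ A E≤) (≤-reflexive (x∙yz≈y∙xz A 10 B))) ve≤

Replace⇒≤2* : ∀ {s t} → Replace s t → t ≤ 2 * s
Replace⇒≤2* (inj₁ refl) = ≤-refl
Replace⇒≤2* {s} {t} (inj₂ refl) = ≤-trans (m≤n*m t 2) (m≤n*m (2 * t) 2)

replacement-length : ∀ {b t e} → All (_< 10) b → Replace (value b) t → DecExp t e → length e ≤ suc (length b)
replacement-length {b} {t} {e} b<10 rep (_ , lead-e , value-e≡t) = s≤s⁻¹ (^-cancelʳ-< 10 (begin-strict
  10 ^ length e            ≤⟨ 10^length≤10*value lead-e ⟩
  10 * value e             ≡⟨ cong (10 *_) value-e≡t ⟩
  10 * t                   ≤⟨ *-monoʳ-≤ 10 (Replace⇒≤2* rep) ⟩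
  10 * (2 * value b)       <⟨ *-monoʳ-< 10 (*-monoʳ-< 2 (value<10^length b<10)) ⟩
  10 * (2 * 10 ^ length b) ≤⟨ *-monoʳ-≤ 10 (*-monoˡ-≤ (10 ^ length b) {2} {10} (s≤s (s≤s z≤n))) ⟩
  10 ^ suc (suc (length b)) ∎))
  where open ≤-Reasoning

Step⇒≤10* : ∀ {m m′} → Step m m′ → m′ ≤ 10 * m
Step⇒≤10* {m} (inj₁ refl) = m≤n*m m 10
Step⇒≤10* (inj₂ (a , b , c , t , e , (abc<10 , _ , refl) , _ , rep , t-exp@(_ , _ , value-e≡t) , refl)) =
  infix-growth a b c e (^-monoʳ-≤ 10 (replacement-length b<10 rep t-exp))
    (≤-trans (≤-reflexive value-e≡t) (≤-trans (Replace⇒≤2* rep) (*-monoˡ-≤ (value b) {2} {10} (s≤s (s≤s z≤n)))))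
  where b<10 = ++⁻ˡ b (++⁻ʳ a abc<10)

Reach-≤-*10^ : ∀ {N B} → (∀ {m} → Reach N m → m ≤ B) → ∀ k {m} → Reach (k + N) m → m ≤ B * 10 ^ k
Reach-≤-*10^ {B = B} bound zero reach = ≤-trans (bound reach) (≤-reflexive (sym (*-identityʳ B)))
Reach-≤-*10^ {B = B} bound (suc k) (step {m = m} {m′} reach s) = begin
  m′                ≤⟨ Step⇒≤10* s ⟩
  10 * m            ≤⟨ *-monoʳ-≤ 10 (Reach-≤-*10^ bound k reach) ⟩
  10 * (B * 10 ^ k) ≡⟨ x∙yz≈y∙xz B 10 (10 ^ k) ⟨
  B * 10 ^ suc k    ∎
  where open ≤-Reasoning

-- Upper bound by pruned search

module Pruning (contenders : ℕ → List ℕ) (N B : ℕ) where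

  Candidate : ℕ → ℕ → Set
  Candidate n m = m ∈ contenders n ⊎ m * 10 ^ (N ∸ n) ≤ B

  Closed : Set
  Closed = ∀ {n m m′} → n < N → m ∈ contenders n → Step m m′ → Candidate (suc n) m′

  Reach⇒Candidate : Candidate 0 1 → Closed → ∀ {n m} → Reach n m → n ≤ N → Candidate n m
  Reach⇒Candidate start-ok _ start _ = start-ok
  Reach⇒Candidate start-ok closed (step {n} {m} {m′} reach s) n<N
    with Reach⇒Candidate start-ok closed reach (<⇒≤ n<N)
  ... | inj₁ m∈ = closed n<N m∈ s
  ... | inj₂ m-small = inj₂ (begin
    m′ * P                  ≤⟨ *-monoˡ-≤ P (Step⇒≤10* s) ⟩
    10 * m * P              ≡⟨ trans (*-assoc 10 m P) (x∙yz≈y∙xz 10 m P) ⟩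
    m * 10 ^ suc (N ∸ suc n) ≡⟨ cong (λ k → m * 10 ^ k) (+-∸-assoc 1 n<N) ⟨
    m * 10 ^ (N ∸ n)        ≤⟨ m-small ⟩
    B                       ∎)
    where open ≤-Reasoning
          P = 10 ^ (N ∸ suc n)

  candidate? : ∀ n m → Dec (Candidate n m)
  candidate? n m = (m ∈? contenders n) ⊎-dec (m * 10 ^ (N ∸ n) ≤? B)

  Certified : ℕ → Set
  Certified n = All (λ m → All (λ s → Candidate (suc n) (proj₁ s)) (successors m)) (contenders n)

  certified? : Dec (∀ (i : Fin N) → Certified (toℕ i))
  certified? = Fin.all? λ i →
    all? (λ m → all? (λ s → candidate? (suc (toℕ i)) (proj₁ s)) (successors m)) (contenders (toℕ i))

  Certified⇒Closed : (∀ (i : Fin N) → Certified (toℕ i)) → Closed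
  Certified⇒Closed certified n<N m∈ s =
    All-∈₁ (lookup (subst Certified (toℕ-fromℕ< n<N) (certified (fromℕ< n<N))) m∈) (successors-complete s)

  extinct⇒bounded : Candidate 0 1 → contenders N ≡ [] → (∀ (i : Fin N) → Certified (toℕ i)) →
                    ∀ {m} → Reach N m → m ≤ B
  extinct⇒bounded start-ok extinct certified {m} reach
    with Reach⇒Candidate start-ok (Certified⇒Closed certified) reach ≤-refl
  ... | inj₁ m∈ = contradiction (subst (m ∈_) extinct m∈) λ ()
  ... | inj₂ m-small =
    ≤-trans (≤-reflexive (sym (*-identityʳ m))) (subst (λ k → m * 10 ^ k ≤ B) (n∸n≡0 N) m-small)

-- Computed by search: the numbers m reachable in n steps through contenders with m · 10^(14 - n) > 8113·10⁵.
contenders : ℕ → List ℕ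
contenders 0 = 1 ∷ []
contenders 1 = 1 ∷ 2 ∷ []
contenders 2 = 1 ∷ 2 ∷ 4 ∷ []
contenders 3 = 1 ∷ 2 ∷ 4 ∷ 8 ∷ []
contenders 4 = 1 ∷ 2 ∷ 4 ∷ 8 ∷ 16 ∷ []
contenders 5 = 1 ∷ 2 ∷ 4 ∷ 8 ∷ 13 ∷ 16 ∷ 26 ∷ 32 ∷ 112 ∷ []
contenders 6 = 13 ∷ 16 ∷ 23 ∷ 26 ∷ 31 ∷ 32 ∷ 34 ∷ 46 ∷ 52 ∷ 56 ∷ 62 ∷ 64 ∷ 111 ∷ 112 ∷ 114 ∷ 122 ∷ 124 ∷ 212 ∷ 222 ∷ 224 ∷ []
contenders 7 = 86 ∷ 92 ∷ 102 ∷ 104 ∷ 106 ∷ 111 ∷ 112 ∷ 114 ∷ 118 ∷ 121 ∷ 122 ∷ 124 ∷ 128 ∷ 142 ∷ 144 ∷ 148 ∷ 211 ∷ 212 ∷ 214 ∷ 221 ∷ 222 ∷ 224 ∷ 228 ∷ 242 ∷ 244 ∷ 248 ∷ 412 ∷ 422 ∷ 424 ∷ 442 ∷ 444 ∷ 448 ∷ 512 ∷ []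
contenders 8 = 812 ∷ 822 ∷ 824 ∷ 842 ∷ 844 ∷ 848 ∷ 882 ∷ 884 ∷ 888 ∷ 896 ∷ 1012 ∷ 1022 ∷ 1024 ∷ 1116 ∷ 1216 ∷ 1416 ∷ 2216 ∷ 2416 ∷ 4416 ∷ []
contenders 9 = 8162 ∷ 8164 ∷ 8168 ∷ 8176 ∷ 8186 ∷ 8192 ∷ 8416 ∷ 8816 ∷ 8826 ∷ 8832 ∷ 8912 ∷ 11112 ∷ 12112 ∷ 14112 ∷ 22112 ∷ 24112 ∷ 44112 ∷ []
contenders 10 = 81136 ∷ 81146 ∷ 81152 ∷ 81166 ∷ 81172 ∷ 81182 ∷ 81184 ∷ 81616 ∷ 81626 ∷ 81632 ∷ 81646 ∷ 81652 ∷ 81662 ∷ 81664 ∷ 81712 ∷ 81812 ∷ 81822 ∷ 81824 ∷ 84112 ∷ 88112 ∷ 88212 ∷ 88222 ∷ 88224 ∷ []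
contenders 11 = 811302 ∷ 811304 ∷ 811312 ∷ 811322 ∷ 811324 ∷ 811328 ∷ 811412 ∷ 811422 ∷ 811424 ∷ 811612 ∷ 811622 ∷ 811624 ∷ 811642 ∷ 811644 ∷ 811648 ∷ 816102 ∷ 816104 ∷ 816112 ∷ 816122 ∷ 816124 ∷ 816128 ∷ 816212 ∷ 816222 ∷ 816224 ∷ 816412 ∷ 816422 ∷ 816424 ∷ 816442 ∷ 816444 ∷ 816448 ∷ []
contenders 12 = 8113216 ∷ 8116416 ∷ 8161216 ∷ 8164416 ∷ []
contenders 13 = 81132112 ∷ 81164112 ∷ 81612112 ∷ 81644112 ∷ []
contenders _ = []

open Pruning contenders 14 (8113 * 10 ^ 5)

Reach-14-≤ : ∀ {m} → Reach 14 m → m ≤ 8113 * 10 ^ 5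
Reach-14-≤ = extinct⇒bounded (inj₁ (here refl)) refl (toWitness {a? = certified?} _)

-- Exponents are kept in terms of n ∸ 14 instead of matching n = 14 + k: the conversion check between
-- 8113 * 10 ^ (14 + k ∸ 9) and 8113 * 10 ^ (5 + k) unfolds the multiplication and takes minutes.
n∸9≡5+[n∸14] : ∀ {n} → 14 ≤ n → n ∸ 9 ≡ 5 + (n ∸ 14)
n∸9≡5+[n∸14] 14≤n = +-∸-assoc 5 14≤n

R-upper : ∀ {n m} → 14 ≤ n → Reach n m → m ≤ 8113 * 10 ^ (n ∸ 9)
R-upper {n} {m} 14≤n reach = begin
  m                         ≤⟨ Reach-≤-*10^ Reach-14-≤ k (subst (λ n → Reach n m) (sym (m∸n+n≡m 14≤n)) reach) ⟩
  8113 * 10 ^ 5 * 10 ^ k    ≡⟨ *-assoc 8113 (10 ^ 5) (10 ^ k) ⟩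
  8113 * (10 ^ 5 * 10 ^ k)  ≡⟨ cong (8113 *_) (^-distribˡ-+-* 10 5 k) ⟨
  8113 * 10 ^ (5 + k)       ≡⟨ cong (λ j → 8113 * 10 ^ j) (n∸9≡5+[n∸14] 14≤n) ⟨
  8113 * 10 ^ (n ∸ 9)       ∎
  where open ≤-Reasoning
        k = n ∸ 14

-- Lower bound along an explicit orbit

Numeral : List ℕ → Set
Numeral ds = DecExp (value ds) ds

infix 4 _↝_
data _↝_ : List ℕ → List ℕ → Set where
  doubleAt : ∀ a b c e → LeadingNonzero b → DecExp (2 * value b) e → a ++ b ++ c ↝ a ++ e ++ c

double : ∀ a b c e {_ : True (lnz? b ×-dec decExp? (2 * value b) e)} → a ++ b ++ c ↝ a ++ e ++ c
double a b c e {ok} = let lead-b , e-exp = toWitness ok in doubleAt a b c e lead-b e-exp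

↝-prefix : ∀ p {xs ys} → xs ↝ ys → p ++ xs ↝ p ++ ys
↝-prefix p (doubleAt a b c e lead-b e-exp) =
  subst₂ _↝_ (++-assoc p a (b ++ c)) (++-assoc p a (e ++ c)) (doubleAt (p ++ a) b c e lead-b e-exp)

↝-Numeral : ∀ {xs ys} → Numeral xs → xs ↝ ys → Numeral ys
↝-Numeral (abc<10 , lead-abc , _) (doubleAt a b c e _ (e<10 , lead-e , _)) =
  ++⁺ (++⁻ˡ a abc<10) (++⁺ e<10 (++⁻ʳ b (++⁻ʳ a abc<10))) , lead-aec a lead-abc , refl
  where
    lead-aec : ∀ a → LeadingNonzero (a ++ b ++ c) → LeadingNonzero (a ++ e ++ c)
    lead-aec [] _ = lead-++ lead-e
    lead-aec (_ ∷ _) (lead d≢0) = lead d≢0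

↝-Step : ∀ {xs ys} → Numeral xs → xs ↝ ys → Step (value xs) (value ys)
↝-Step xs-num (doubleAt a b c e lead-b e-exp) =
  inj₂ (a , b , c , 2 * value b , e , xs-num , lead-b , inj₁ refl , e-exp , refl)

Reached : ℕ → List ℕ → Set
Reached n ds = Numeral ds × Reach n (value ds)

infixl 5 _▸_
_▸_ : ∀ {n xs ys} → Reached n xs → xs ↝ ys → Reached (suc n) ys
(xs-num , reach) ▸ xs↝ys = ↝-Numeral xs-num xs↝ys , step reach (↝-Step xs-num xs↝ys)

origin : Reached 0 (1 ∷ [])
origin = (s≤s (s≤s z≤n) ∷ [] , lead (λ ()) , refl) , start

cycle : ℕ → List ℕ
cycle 0 = 8 ∷ 2 ∷ 2 ∷ 4 ∷ []
cycle 1 = 1 ∷ 6 ∷ 4 ∷ 4 ∷ 8 ∷ []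
cycle 2 = 1 ∷ 6 ∷ 4 ∷ 4 ∷ 1 ∷ 6 ∷ []
cycle 3 = 1 ∷ 6 ∷ 4 ∷ 4 ∷ 1 ∷ 1 ∷ 2 ∷ []
cycle (suc (suc (suc (suc i)))) = 1 ∷ 1 ∷ 2 ∷ 8 ∷ cycle i

cycle-↝ : ∀ i → cycle i ↝ cycle (suc i)
cycle-↝ 0 = double [] (8 ∷ 2 ∷ 2 ∷ 4 ∷ []) [] (1 ∷ 6 ∷ 4 ∷ 4 ∷ 8 ∷ [])
cycle-↝ 1 = double (1 ∷ 6 ∷ 4 ∷ 4 ∷ []) (8 ∷ []) [] (1 ∷ 6 ∷ [])
cycle-↝ 2 = double (1 ∷ 6 ∷ 4 ∷ 4 ∷ 1 ∷ []) (6 ∷ []) [] (1 ∷ 2 ∷ [])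
cycle-↝ 3 = double (1 ∷ []) (6 ∷ 4 ∷ 4 ∷ 1 ∷ 1 ∷ 2 ∷ []) [] (1 ∷ 2 ∷ 8 ∷ 8 ∷ 2 ∷ 2 ∷ 4 ∷ [])
cycle-↝ (suc (suc (suc (suc i)))) = ↝-prefix (1 ∷ 1 ∷ 2 ∷ 8 ∷ []) (cycle-↝ i)

length-cycle : ∀ i → length (cycle i) ≡ 4 + i
length-cycle 0 = refl
length-cycle 1 = refl
length-cycle 2 = refl
length-cycle 3 = refl
length-cycle (suc (suc (suc (suc i)))) = cong (4 +_) (length-cycle i)

orbit : ∀ i → Reached (10 + i) (8 ∷ cycle i)
orbit zero = origin
  ▸ double [] (1 ∷ []) [] (2 ∷ [])
  ▸ double [] (2 ∷ []) [] (4 ∷ [])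
  ▸ double [] (4 ∷ []) [] (8 ∷ [])
  ▸ double [] (8 ∷ []) [] (1 ∷ 6 ∷ [])
  ▸ double (1 ∷ []) (6 ∷ []) [] (1 ∷ 2 ∷ [])
  ▸ double [] (1 ∷ 1 ∷ 2 ∷ []) [] (2 ∷ 2 ∷ 4 ∷ [])
  ▸ double [] (2 ∷ 2 ∷ 4 ∷ []) [] (4 ∷ 4 ∷ 8 ∷ [])
  ▸ double (4 ∷ 4 ∷ []) (8 ∷ []) [] (1 ∷ 6 ∷ [])
  ▸ double (4 ∷ 4 ∷ 1 ∷ []) (6 ∷ []) [] (1 ∷ 2 ∷ [])
  ▸ double [] (4 ∷ 4 ∷ 1 ∷ 1 ∷ 2 ∷ []) [] (8 ∷ 8 ∷ 2 ∷ 2 ∷ 4 ∷ [])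
orbit (suc i) = orbit i ▸ ↝-prefix (8 ∷ []) (cycle-↝ i)

orbit-lower : ∀ k → 8112 * 10 ^ (5 + k) < value (8 ∷ cycle (4 + k))
orbit-lower k = begin-strict
  8112 * (10 * P)                      ≡⟨ *-assoc 8112 10 P ⟨
  81120 * P                            <⟨ *-monoˡ-< P {{m^n≢0 10 (4 + k)}} (m<m+n 81120 {8} (s≤s z≤n)) ⟩
  81128 * P                            ≤⟨ m≤m+n (81128 * P) (value (cycle k)) ⟩
  81128 * P + value (cycle k)          ≡⟨ cong (λ l → 81128 * 10 ^ l + value (cycle k)) (length-cycle k) ⟨
  81128 * 10 ^ length (cycle k) + value (cycle k) ≡⟨ value-++ (8 ∷ 1 ∷ 1 ∷ 2 ∷ 8 ∷ []) (cycle k) ⟨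
  value (8 ∷ cycle (4 + k))            ∎
  where open ≤-Reasoning
        P = 10 ^ (4 + k)

R-lower : ∀ {n} → 14 ≤ n → Σ ℕ λ w → Reach n w × 8112 * 10 ^ (n ∸ 9) < w
R-lower {n} 14≤n =
  w , subst (λ n → Reach n w) (m+[n∸m]≡n 14≤n) (proj₂ (orbit (4 + k))) ,
      subst (λ j → 8112 * 10 ^ j < w) (sym (n∸9≡5+[n∸14] 14≤n)) (orbit-lower k)
  where k = n ∸ 14
        w = value (8 ∷ cycle (4 + k))

theorem6 : (n : ℕ) → 14 ≤ n →
    Σ ℕ (λ r → IsR n r × (8112 * 10 ^ (n ∸ 9) < r) × (r ≤ 8113 * 10 ^ (n ∸ 9)))
theorem6 n 14≤n =
  let w , reach-w , w-large = R-lower 14≤n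
      r , isR , w≤r = maximum (reachables n) reachables-complete (w , reach-w)
  in r , isR , <-≤-trans w-large w≤r , R-upper 14≤n (proj₁ isR)
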